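{- Let $a,b$ be nonzero real numbers and let $(q_n)_{n\in\mathbb{Z}}$ and $(l_n)_{n\in\mathbb{Z}}$ be the bi-periodic Fibonacci and bi-periodic Lucas sequences with parameters $a,b$. Then for all integers $m,n$: \begin{itemize} \item[(i)] $(ab+4)\,q_{2(m+n+1)}=l_{2m+1}l_{2(n+1)}+l_{2m}l_{2n+1}$; \item[(ii)] $q_{2(m+n)}=q_{2m}q_{2n+1}+q_{2m-1}q_{2n}$; \item[(iii)] $l_{2(m+n)+1}=l_{2m+1}q_{2n+1}+l_{2m}q_{2n}$; \item[(iv)] $(ab+4)\,q_{2(m-n)}=l_{2m+1}l_{2(n+1)}-l_{2(m+1)}l_{2n+1}$; \item[(v)] $q_{2(m-n)}=q_{2m}q_{2n+1}-q_{2m+1}q_{2n}$; \item[(vi)] $l_{2(m-n)+1}=q_{2(m+1)}l_{2n}-q_{2m+1}l_{2n+1}$. \end{itemize}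
   Context: The bi-periodic Fibonacci sequence $(q_n)$ is defined by $q_0=0$, $q_1=1$, and $q_n=aq_{n-1}+q_{n-2}$ if $n$ is even, $q_n=bq_{n-1}+q_{n-2}$ if $n$ is odd. The bi-periodic Lucas sequence $(l_n)$ is defined by $l_0=2$, $l_1=a$, and $l_n=bl_{n-1}+l_{n-2}$ if $n$ is even, $l_n=al_{n-1}+l_{n-2}$ if $n$ is odd. These recurrences are required to hold for all integers $n$, which extends both sequences uniquely to negative indices. -}

module Defs where

open import Level using (Level)
open import Algebra.Bundles using (CommutativeRing)
open import Data.Product using (_×_)
import Data.Integer as ℤ
open ℤ using (ℤ)

module _ {c ℓ : Level} (R : CommutativeRing c ℓ) where
  open CommutativeRing R

  four : Carrier
  four = 1# + 1# + 1# + 1#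

  IsBiFibonacci : Carrier → Carrier → (ℤ → Carrier) → Set ℓ
  IsBiFibonacci a b q =
    (q (ℤ.+ 0) ≈ 0#) × (q (ℤ.+ 1) ≈ 1#) ×
    (∀ k → q (ℤ.+ 2 ℤ.* k) ≈ a * q (ℤ.+ 2 ℤ.* k ℤ.- ℤ.+ 1) + q (ℤ.+ 2 ℤ.* k ℤ.- ℤ.+ 2)) ×
    (∀ k → q (ℤ.+ 2 ℤ.* k ℤ.+ ℤ.+ 1) ≈ b * q (ℤ.+ 2 ℤ.* k) + q (ℤ.+ 2 ℤ.* k ℤ.- ℤ.+ 1))

  IsBiLucas : Carrier → Carrier → (ℤ → Carrier) → Set ℓ
  IsBiLucas a b l =
    (l (ℤ.+ 0) ≈ 1# + 1#) × (l (ℤ.+ 1) ≈ a) ×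
    (∀ k → l (ℤ.+ 2 ℤ.* k) ≈ b * l (ℤ.+ 2 ℤ.* k ℤ.- ℤ.+ 1) + l (ℤ.+ 2 ℤ.* k ℤ.- ℤ.+ 2)) ×
    (∀ k → l (ℤ.+ 2 ℤ.* k ℤ.+ ℤ.+ 1) ≈ a * l (ℤ.+ 2 ℤ.* k) + l (ℤ.+ 2 ℤ.* k ℤ.- ℤ.+ 1))

{-# OPTIONS --safe #-}
-- The even- and odd-indexed subsequences of q and of l all satisfy one and the same recurrence
-- xₖ₊₁ + xₖ₋₁ = (ab + 2) xₖ, and a two-sided solution of it is determined by x₀ and x₁.  For fixed m,
-- both sides of (ii), (iii) and of (v), (vi) with the subtracted term moved to the left are such
-- solutions in n, so it suffices to compare them at n = 0 and n = 1.  The same argument gives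
-- l₂ₖ = q₂ₖ₋₁ + q₂ₖ₊₁ and l₂ₖ₊₁ = q₂ₖ + q₂ₖ₊₂, through which (i) follows from (iii) and (iv) from (v).
module Submission where

open import Defs
open import Level using (Level)
open import Algebra.Bundles using (CommutativeRing)
open import Data.Nat using (zero; suc)
import Data.Nat.Properties as ℕ
open import Data.Product using (_×_; _,_; proj₁; proj₂)
open import Relation.Nullary using (¬_)
import Data.Integer as ℤ
open ℤ using (ℤ; -[1+_])
import Data.Integer.Properties as ℤP
import Data.Integer.Tactic.RingSolver as ℤ-Solver
import Relation.Binary.PropositionalEquality as ≡
open ≡ using (_≡_)

module Index where
  open import Data.Integer using (_+_; _-_; _*_; +_)

  2k-1≡2[k-1]+1 : ∀ k → + 2 * k - + 1 ≡ + 2 * (k - + 1) + + 1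
  2k-1≡2[k-1]+1 = ℤ-Solver.solve-∀

  2k-2≡2[k-1] : ∀ k → + 2 * k - + 2 ≡ + 2 * (k - + 1)
  2k-2≡2[k-1] = ℤ-Solver.solve-∀

  k+1-1≡k : ∀ k → k + + 1 - + 1 ≡ k
  k+1-1≡k = ℤ-Solver.solve-∀

  k-1+1≡k : ∀ k → k - + 1 + + 1 ≡ k
  k-1+1≡k = ℤ-Solver.solve-∀

  m+[k+1]≡m+k+1 : ∀ m k → m + (k + + 1) ≡ m + k + + 1
  m+[k+1]≡m+k+1 = ℤ-Solver.solve-∀

  m+[k-1]≡m+k-1 : ∀ m k → m + (k - + 1) ≡ m + k - + 1
  m+[k-1]≡m+k-1 = ℤ-Solver.solve-∀

  m-[k+1]≡m-k-1 : ∀ m k → m - (k + + 1) ≡ m - k - + 1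
  m-[k+1]≡m-k-1 = ℤ-Solver.solve-∀

  m-[k-1]≡m-k+1 : ∀ m k → m - (k - + 1) ≡ m - k + + 1
  m-[k-1]≡m-k+1 = ℤ-Solver.solve-∀

  m+1-k≡m-k+1 : ∀ m k → m + + 1 - k ≡ m - k + + 1
  m+1-k≡m-k+1 = ℤ-Solver.solve-∀

  m+1-[k+1]≡m-k : ∀ m k → m + + 1 - (k + + 1) ≡ m - k
  m+1-[k+1]≡m-k = ℤ-Solver.solve-∀

module LinearRecurrence {c ℓ : Level} (R : CommutativeRing c ℓ) where
  open CommutativeRing R
  open import Algebra.Properties.Group +-group using (∙-cancelʳ)
  open import Algebra.Properties.CommutativeSemigroup +-commutativeSemigroup using (interchange)
  open import Algebra.Properties.CommutativeSemigroup *-commutativeSemigroup using (x∙yz≈y∙xz)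
  open import Relation.Binary.Reasoning.Setoid setoid
  open import Algebra.Solver.Ring.NaturalCoefficients.Default commutativeSemiring
  open Index

  two : Carrier
  two = 1# + 1#

  at : (f : ℤ → Carrier) {i j : ℤ} → i ≡ j → f i ≈ f j
  at f i≡j = reflexive (≡.cong f i≡j)

  Recurrent : Carrier → (ℤ → Carrier) → Set ℓ
  Recurrent κ f = ∀ k → f (k ℤ.+ ℤ.+ 1) + f (k ℤ.- ℤ.+ 1) ≈ κ * f k

  module _ {κ : Carrier} where

    recurrent-resp : ∀ {κ′ f g} → κ ≈ κ′ → (∀ k → f k ≈ g k) → Recurrent κ f → Recurrent κ′ g
    recurrent-resp {κ′} {f} {g} κ≈κ′ f≈g rf k = begin
      g (k ℤ.+ ℤ.+ 1) + g (k ℤ.- ℤ.+ 1) ≈⟨ +-cong (f≈g (k ℤ.+ ℤ.+ 1)) (f≈g (k ℤ.- ℤ.+ 1)) ⟨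
      f (k ℤ.+ ℤ.+ 1) + f (k ℤ.- ℤ.+ 1) ≈⟨ rf k ⟩
      κ * f k                           ≈⟨ *-cong κ≈κ′ (f≈g k) ⟩
      κ′ * g k                          ∎

    recurrent-+ : ∀ {f g} → Recurrent κ f → Recurrent κ g → Recurrent κ (λ k → f k + g k)
    recurrent-+ {f} {g} rf rg k = begin
      (f (k ℤ.+ ℤ.+ 1) + g (k ℤ.+ ℤ.+ 1)) + (f (k ℤ.- ℤ.+ 1) + g (k ℤ.- ℤ.+ 1)) ≈⟨ interchange _ _ _ _ ⟩
      (f (k ℤ.+ ℤ.+ 1) + f (k ℤ.- ℤ.+ 1)) + (g (k ℤ.+ ℤ.+ 1) + g (k ℤ.- ℤ.+ 1)) ≈⟨ +-cong (rf k) (rg k) ⟩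
      κ * f k + κ * g k                                                         ≈⟨ distribˡ κ (f k) (g k) ⟨
      κ * (f k + g k)                                                           ∎

    recurrent-* : ∀ {f} x → Recurrent κ f → Recurrent κ (λ k → x * f k)
    recurrent-* {f} x rf k = begin
      x * f (k ℤ.+ ℤ.+ 1) + x * f (k ℤ.- ℤ.+ 1) ≈⟨ distribˡ x _ _ ⟨
      x * (f (k ℤ.+ ℤ.+ 1) + f (k ℤ.- ℤ.+ 1))   ≈⟨ *-congˡ (rf k) ⟩
      x * (κ * f k)                             ≈⟨ x∙yz≈y∙xz x κ (f k) ⟩
      κ * (x * f k)                             ∎

    recurrent-translate : ∀ {f} m → Recurrent κ f → Recurrent κ (λ k → f (m ℤ.+ k))
    recurrent-translate {f} m rf k = begin
      f (m ℤ.+ (k ℤ.+ ℤ.+ 1)) + f (m ℤ.+ (k ℤ.- ℤ.+ 1))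
        ≈⟨ +-cong (at f (m+[k+1]≡m+k+1 m k)) (at f (m+[k-1]≡m+k-1 m k)) ⟩
      f (m ℤ.+ k ℤ.+ ℤ.+ 1) + f (m ℤ.+ k ℤ.- ℤ.+ 1)
        ≈⟨ rf (m ℤ.+ k) ⟩
      κ * f (m ℤ.+ k) ∎

    recurrent-translateʳ : ∀ {f} m → Recurrent κ f → Recurrent κ (λ k → f (k ℤ.+ m))
    recurrent-translateʳ {f} m rf =
      recurrent-resp refl (λ k → at f (ℤP.+-comm m k)) (recurrent-translate m rf)

    recurrent-reflect : ∀ {f} m → Recurrent κ f → Recurrent κ (λ k → f (m ℤ.- k))
    recurrent-reflect {f} m rf k = begin
      f (m ℤ.- (k ℤ.+ ℤ.+ 1)) + f (m ℤ.- (k ℤ.- ℤ.+ 1))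
        ≈⟨ +-cong (at f (m-[k+1]≡m-k-1 m k)) (at f (m-[k-1]≡m-k+1 m k)) ⟩
      f (m ℤ.- k ℤ.- ℤ.+ 1) + f (m ℤ.- k ℤ.+ ℤ.+ 1)
        ≈⟨ +-comm _ _ ⟩
      f (m ℤ.- k ℤ.+ ℤ.+ 1) + f (m ℤ.- k ℤ.- ℤ.+ 1)
        ≈⟨ rf (m ℤ.- k) ⟩
      κ * f (m ℤ.- k) ∎

    private
      successor-agrees : ∀ {f g} → Recurrent κ f → Recurrent κ g →
                         ∀ k → f (k ℤ.- ℤ.+ 1) ≈ g (k ℤ.- ℤ.+ 1) → f k ≈ g k → f (k ℤ.+ ℤ.+ 1) ≈ g (k ℤ.+ ℤ.+ 1)
      successor-agrees {f} {g} rf rg k e₋ e = ∙-cancelʳ (g (k ℤ.- ℤ.+ 1)) _ _ (begin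
        f (k ℤ.+ ℤ.+ 1) + g (k ℤ.- ℤ.+ 1) ≈⟨ +-congˡ e₋ ⟨
        f (k ℤ.+ ℤ.+ 1) + f (k ℤ.- ℤ.+ 1) ≈⟨ rf k ⟩
        κ * f k                           ≈⟨ *-congˡ e ⟩
        κ * g k                           ≈⟨ rg k ⟨
        g (k ℤ.+ ℤ.+ 1) + g (k ℤ.- ℤ.+ 1) ∎)

      agree-on-ℕ : ∀ {f g} → Recurrent κ f → Recurrent κ g → f (ℤ.+ 0) ≈ g (ℤ.+ 0) → f (ℤ.+ 1) ≈ g (ℤ.+ 1) →
                   ∀ n → f (ℤ.+ n) ≈ g (ℤ.+ n) × f (ℤ.+ suc n) ≈ g (ℤ.+ suc n)
      agree-on-ℕ rf rg e₀ e₁ zero = e₀ , e₁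
      agree-on-ℕ {f} {g} rf rg e₀ e₁ (suc n) with agree-on-ℕ rf rg e₀ e₁ n
      ... | eₙ , eₙ₊₁ = eₙ₊₁ , ≡.subst (λ i → f i ≈ g i) (≡.cong ℤ.+_ (ℕ.+-comm (suc n) 1))
                                       (successor-agrees rf rg (ℤ.+ suc n) eₙ eₙ₊₁)

    -- The reflection k ↦ 1 - k swaps the base points 0 and 1 and sends ℕ onto the integers ≤ 1.
    recurrent-unique : ∀ {f g} → Recurrent κ f → Recurrent κ g → f (ℤ.+ 0) ≈ g (ℤ.+ 0) → f (ℤ.+ 1) ≈ g (ℤ.+ 1) →
                       ∀ k → f k ≈ g k
    recurrent-unique rf rg e₀ e₁ (ℤ.+ n)  = proj₁ (agree-on-ℕ rf rg e₀ e₁ n)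
    recurrent-unique rf rg e₀ e₁ -[1+ n ] =
      proj₂ (agree-on-ℕ (recurrent-reflect (ℤ.+ 1) rf) (recurrent-reflect (ℤ.+ 1) rg) e₁ e₀ (suc n))

  -- Applied to (y, z, u, v, w) = (x₂ₖ₊₂, x₂ₖ₊₁, x₂ₖ, x₂ₖ₋₁, x₂ₖ₋₂) and to the same window shifted by one.
  interlaced-recurrence : ∀ {p q u v w y z} → y ≈ p * z + u → z ≈ q * u + v → u ≈ p * v + w →
                          y + w ≈ (p * q + two) * u
  interlaced-recurrence {p} {q} {u} {v} {w} {y} {z} y≈ z≈ u≈ = begin
    y + w                             ≈⟨ +-congʳ (trans y≈ (+-congʳ (*-congˡ z≈))) ⟩
    (p * (q * u + v) + u) + w         ≈⟨ solve 5 (λ p q u v w → (p :* (q :* u :+ v) :+ u) :+ w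
                                                   := (p :* q :+ con 1) :* u :+ (p :* v :+ w)) refl p q u v w ⟩
    (p * q + 1#) * u + (p * v + w)    ≈⟨ +-congˡ u≈ ⟨
    (p * q + 1#) * u + u              ≈⟨ solve 3 (λ p q u → (p :* q :+ con 1) :* u :+ u
                                                   := (p :* q :+ (con 1 :+ con 1)) :* u) refl p q u ⟩
    (p * q + two) * u                 ∎

module BiPeriodic {c ℓ : Level} (R : CommutativeRing c ℓ) where
  open CommutativeRing R
  open LinearRecurrence R
  open Index

  module Parts (α β : Carrier) (x : ℤ → Carrier)
    (even-step : ∀ k → x (ℤ.+ 2 ℤ.* k) ≈ α * x (ℤ.+ 2 ℤ.* k ℤ.- ℤ.+ 1) + x (ℤ.+ 2 ℤ.* k ℤ.- ℤ.+ 2))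
    (odd-step : ∀ k → x (ℤ.+ 2 ℤ.* k ℤ.+ ℤ.+ 1) ≈ β * x (ℤ.+ 2 ℤ.* k) + x (ℤ.+ 2 ℤ.* k ℤ.- ℤ.+ 1))
    where

    evens odds : ℤ → Carrier
    evens k = x (ℤ.+ 2 ℤ.* k)
    odds  k = x (ℤ.+ 2 ℤ.* k ℤ.+ ℤ.+ 1)

    evens-step : ∀ k → evens k ≈ α * odds (k ℤ.- ℤ.+ 1) + evens (k ℤ.- ℤ.+ 1)
    evens-step k = trans (even-step k)
                         (+-cong (*-congˡ (at x (2k-1≡2[k-1]+1 k))) (at x (2k-2≡2[k-1] k)))

    odds-step : ∀ k → odds k ≈ β * evens k + odds (k ℤ.- ℤ.+ 1)
    odds-step k = trans (odd-step k) (+-congˡ (at x (2k-1≡2[k-1]+1 k)))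

    evens-suc : ∀ k → evens (k ℤ.+ ℤ.+ 1) ≈ α * odds k + evens k
    evens-suc k = trans (evens-step (k ℤ.+ ℤ.+ 1))
                        (+-cong (*-congˡ (at odds (k+1-1≡k k))) (at evens (k+1-1≡k k)))

    odds-suc : ∀ k → odds (k ℤ.+ ℤ.+ 1) ≈ β * evens (k ℤ.+ ℤ.+ 1) + odds k
    odds-suc k = trans (odds-step (k ℤ.+ ℤ.+ 1)) (+-congˡ (at odds (k+1-1≡k k)))

    evens-recurrent : Recurrent (α * β + two) evens
    evens-recurrent k = interlaced-recurrence (evens-suc k) (odds-step k) (evens-step k)

    odds-recurrent : Recurrent (β * α + two) odds
    odds-recurrent k = interlaced-recurrence (odds-suc k) (evens-suc k) (odds-step k)

module BiPeriodicIdentities {c ℓ : Level} (R : CommutativeRing c ℓ) (a b : CommutativeRing.Carrier R)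
  (q l : ℤ → CommutativeRing.Carrier R) (hq : IsBiFibonacci R a b q) (hl : IsBiLucas R a b l)
  where
  open CommutativeRing R
  open LinearRecurrence R
  open Index
  open import Relation.Binary.Reasoning.Setoid setoid
  open import Algebra.Solver.Ring.NaturalCoefficients.Default commutativeSemiring

  private
    module Q = BiPeriodic.Parts R a b q (proj₁ (proj₂ (proj₂ hq))) (proj₂ (proj₂ (proj₂ hq)))
    module L = BiPeriodic.Parts R b a l (proj₁ (proj₂ (proj₂ hl))) (proj₂ (proj₂ (proj₂ hl)))

  open Q using () renaming (evens to qᵉ; odds to qᵒ)
  open L using () renaming (evens to lᵉ; odds to lᵒ)

  κ Δ : Carrier
  κ = a * b + two
  Δ = a * b + four R

  qᵉ-recurrent : Recurrent κ qᵉ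
  qᵉ-recurrent = Q.evens-recurrent

  qᵒ-recurrent : Recurrent κ qᵒ
  qᵒ-recurrent = recurrent-resp (+-congʳ (*-comm b a)) (λ _ → refl) Q.odds-recurrent

  lᵉ-recurrent : Recurrent κ lᵉ
  lᵉ-recurrent = recurrent-resp (+-congʳ (*-comm b a)) (λ _ → refl) L.evens-recurrent

  lᵒ-recurrent : Recurrent κ lᵒ
  lᵒ-recurrent = L.odds-recurrent

  qᵉ-0 : qᵉ (ℤ.+ 0) ≈ 0#
  qᵉ-0 = proj₁ hq

  qᵒ-0 : qᵒ (ℤ.+ 0) ≈ 1#
  qᵒ-0 = proj₁ (proj₂ hq)

  lᵉ-0 : lᵉ (ℤ.+ 0) ≈ two
  lᵉ-0 = proj₁ hl

  lᵒ-0 : lᵒ (ℤ.+ 0) ≈ a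
  lᵒ-0 = proj₁ (proj₂ hl)

  qᵒ-−1 : qᵒ ℤ.-1ℤ ≈ 1#
  qᵒ-−1 = sym (begin
    1#                        ≈⟨ qᵒ-0 ⟨
    qᵒ (ℤ.+ 0)                ≈⟨ Q.odds-step (ℤ.+ 0) ⟩
    b * qᵉ (ℤ.+ 0) + qᵒ ℤ.-1ℤ ≈⟨ +-congʳ (trans (*-congˡ qᵉ-0) (zeroʳ b)) ⟩
    0# + qᵒ ℤ.-1ℤ             ≈⟨ +-identityˡ _ ⟩
    qᵒ ℤ.-1ℤ                  ∎)

  qᵉ-1 : qᵉ (ℤ.+ 1) ≈ a
  qᵉ-1 = begin
    qᵉ (ℤ.+ 1)                   ≈⟨ Q.evens-suc (ℤ.+ 0) ⟩
    a * qᵒ (ℤ.+ 0) + qᵉ (ℤ.+ 0)  ≈⟨ +-cong (*-congˡ qᵒ-0) qᵉ-0 ⟩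
    a * 1# + 0#                  ≈⟨ solve 1 (λ a → a :* con 1 :+ con 0 := a) refl a ⟩
    a                            ∎

  qᵒ-1 : qᵒ (ℤ.+ 1) ≈ b * a + 1#
  qᵒ-1 = trans (Q.odds-step (ℤ.+ 1)) (+-cong (*-congˡ qᵉ-1) qᵒ-0)

  qᵉ-2 : qᵉ (ℤ.+ 2) ≈ a * (b * a + 1#) + a
  qᵉ-2 = trans (Q.evens-suc (ℤ.+ 1)) (+-cong (*-congˡ qᵒ-1) qᵉ-1)

  lᵉ-1 : lᵉ (ℤ.+ 1) ≈ b * a + two
  lᵉ-1 = trans (L.evens-suc (ℤ.+ 0)) (+-cong (*-congˡ lᵒ-0) lᵉ-0)

  lᵒ-1 : lᵒ (ℤ.+ 1) ≈ a * (b * a + two) + a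
  lᵒ-1 = trans (L.odds-step (ℤ.+ 1)) (+-cong (*-congˡ lᵉ-1) lᵒ-0)

  lᵉ-as-qᵒ : ∀ k → lᵉ k ≈ qᵒ (k ℤ.- ℤ.+ 1) + qᵒ k
  lᵉ-as-qᵒ = recurrent-unique lᵉ-recurrent
    (recurrent-+ (recurrent-translateʳ ℤ.-1ℤ qᵒ-recurrent) qᵒ-recurrent)
    (trans lᵉ-0 (sym (+-cong qᵒ-−1 qᵒ-0)))
    (begin
      lᵉ (ℤ.+ 1)               ≈⟨ lᵉ-1 ⟩
      b * a + two              ≈⟨ solve 2 (λ a b → b :* a :+ (con 1 :+ con 1) := con 1 :+ (b :* a :+ con 1))
                                          refl a b ⟩
      1# + (b * a + 1#)        ≈⟨ +-cong qᵒ-0 qᵒ-1 ⟨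
      qᵒ (ℤ.+ 0) + qᵒ (ℤ.+ 1)  ∎)

  lᵉ-suc-as-qᵒ : ∀ k → lᵉ (k ℤ.+ ℤ.+ 1) ≈ qᵒ k + qᵒ (k ℤ.+ ℤ.+ 1)
  lᵉ-suc-as-qᵒ k = trans (lᵉ-as-qᵒ (k ℤ.+ ℤ.+ 1)) (+-congʳ (at qᵒ (k+1-1≡k k)))

  lᵒ-as-qᵉ : ∀ k → lᵒ k ≈ qᵉ k + qᵉ (k ℤ.+ ℤ.+ 1)
  lᵒ-as-qᵉ = recurrent-unique lᵒ-recurrent
    (recurrent-+ qᵉ-recurrent (recurrent-translateʳ (ℤ.+ 1) qᵉ-recurrent))
    (trans lᵒ-0 (sym (trans (+-cong qᵉ-0 qᵉ-1) (+-identityˡ a))))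
    (begin
      lᵒ (ℤ.+ 1)                  ≈⟨ lᵒ-1 ⟩
      a * (b * a + two) + a       ≈⟨ solve 2 (λ a b → a :* (b :* a :+ (con 1 :+ con 1)) :+ a
                                                  := a :+ (a :* (b :* a :+ con 1) :+ a)) refl a b ⟩
      a + (a * (b * a + 1#) + a)  ≈⟨ +-cong qᵉ-1 qᵉ-2 ⟨
      qᵉ (ℤ.+ 1) + qᵉ (ℤ.+ 2)     ∎)

  Δqᵉ-expand : ∀ k → Δ * qᵉ k ≈ two * qᵉ k + (qᵉ (k ℤ.+ ℤ.+ 1) + qᵉ (k ℤ.- ℤ.+ 1))
  Δqᵉ-expand k = begin
    Δ * qᵉ k
      ≈⟨ solve 3 (λ a b x → (a :* b :+ con 4) :* x := (con 1 :+ con 1) :* x :+ (a :* b :+ (con 1 :+ con 1)) :* x)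
                 refl a b (qᵉ k) ⟩
    two * qᵉ k + κ * qᵉ k
      ≈⟨ +-congˡ (qᵉ-recurrent k) ⟨
    two * qᵉ k + (qᵉ (k ℤ.+ ℤ.+ 1) + qᵉ (k ℤ.- ℤ.+ 1)) ∎

  Δqᵉ-suc-as-lᵒ : ∀ k → Δ * qᵉ (k ℤ.+ ℤ.+ 1) ≈ lᵒ k + lᵒ (k ℤ.+ ℤ.+ 1)
  Δqᵉ-suc-as-lᵒ k = begin
    Δ * qᵉ k₁                                    ≈⟨ Δqᵉ-expand k₁ ⟩
    two * qᵉ k₁ + (qᵉ k₂ + qᵉ (k₁ ℤ.- ℤ.+ 1))    ≈⟨ +-congˡ (+-congˡ (at qᵉ (k+1-1≡k k))) ⟩
    two * qᵉ k₁ + (qᵉ k₂ + qᵉ k)                 ≈⟨ solve 3 (λ x y z → (con 1 :+ con 1) :* y :+ (z :+ x)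
                                                                := (x :+ y) :+ (y :+ z)) refl (qᵉ k) (qᵉ k₁) (qᵉ k₂) ⟩
    (qᵉ k + qᵉ k₁) + (qᵉ k₁ + qᵉ k₂)             ≈⟨ +-cong (lᵒ-as-qᵉ k) (lᵒ-as-qᵉ k₁) ⟨
    lᵒ k + lᵒ k₁                                 ∎
    where
      k₁ k₂ : ℤ
      k₁ = k ℤ.+ ℤ.+ 1
      k₂ = k₁ ℤ.+ ℤ.+ 1

  combination-at-0 : ∀ x y → x ≈ x * qᵒ (ℤ.+ 0) + y * qᵉ (ℤ.+ 0)
  combination-at-0 x y = begin
    x                                   ≈⟨ solve 2 (λ x y → x := x :* con 1 :+ y :* con 0) refl x y ⟩
    x * 1# + y * 0#                     ≈⟨ +-cong (*-congˡ qᵒ-0) (*-congˡ qᵉ-0) ⟨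
    x * qᵒ (ℤ.+ 0) + y * qᵉ (ℤ.+ 0)     ∎

  combination-at-1 : ∀ x y → a * (b * x + y) + x ≈ x * qᵒ (ℤ.+ 1) + y * qᵉ (ℤ.+ 1)
  combination-at-1 x y = begin
    a * (b * x + y) + x                 ≈⟨ solve 4 (λ a b x y → a :* (b :* x :+ y) :+ x := x :* (b :* a :+ con 1) :+ y :* a)
                                                   refl a b x y ⟩
    x * (b * a + 1#) + y * a            ≈⟨ +-cong (*-congˡ qᵒ-1) (*-congˡ qᵉ-1) ⟨
    x * qᵒ (ℤ.+ 1) + y * qᵉ (ℤ.+ 1)     ∎

  qᵉ-addition : ∀ m n → qᵉ (m ℤ.+ n) ≈ qᵉ m * qᵒ n + qᵒ (m ℤ.- ℤ.+ 1) * qᵉ n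
  qᵉ-addition m = recurrent-unique (recurrent-translate m qᵉ-recurrent)
    (recurrent-+ (recurrent-* (qᵉ m) qᵒ-recurrent) (recurrent-* (qᵒ (m ℤ.- ℤ.+ 1)) qᵉ-recurrent))
    (trans (at qᵉ (ℤP.+-identityʳ m)) (combination-at-0 _ _))
    (trans (Q.evens-suc m) (trans (+-congʳ (*-congˡ (Q.odds-step m))) (combination-at-1 _ _)))

  lᵒ-addition : ∀ m n → lᵒ (m ℤ.+ n) ≈ lᵒ m * qᵒ n + lᵉ m * qᵉ n
  lᵒ-addition m = recurrent-unique (recurrent-translate m lᵒ-recurrent)
    (recurrent-+ (recurrent-* (lᵒ m) qᵒ-recurrent) (recurrent-* (lᵉ m) qᵉ-recurrent))
    (trans (at lᵒ (ℤP.+-identityʳ m)) (combination-at-0 _ _))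
    (trans (L.odds-suc m) (trans (+-congʳ (*-congˡ (L.evens-suc m))) (combination-at-1 _ _)))

  qᵉ-subtraction : ∀ m n → qᵉ (m ℤ.- n) + qᵒ m * qᵉ n ≈ qᵉ m * qᵒ n
  qᵉ-subtraction m = recurrent-unique
    (recurrent-+ (recurrent-reflect m qᵉ-recurrent) (recurrent-* (qᵒ m) qᵉ-recurrent))
    (recurrent-* (qᵉ m) qᵒ-recurrent)
    (begin
      qᵉ (m ℤ.- ℤ.+ 0) + qᵒ m * qᵉ (ℤ.+ 0) ≈⟨ +-cong (at qᵉ (ℤP.+-identityʳ m)) (*-congˡ qᵉ-0) ⟩
      qᵉ m + qᵒ m * 0#                     ≈⟨ solve 2 (λ x y → x :+ y :* con 0 := x :* con 1) refl (qᵉ m) (qᵒ m) ⟩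
      qᵉ m * 1#                            ≈⟨ *-congˡ qᵒ-0 ⟨
      qᵉ m * qᵒ (ℤ.+ 0)                    ∎)
    (begin
      qᵉₘ₋₁ + qᵒ m * qᵉ (ℤ.+ 1)              ≈⟨ +-congˡ (*-cong (Q.odds-step m) qᵉ-1) ⟩
      qᵉₘ₋₁ + (b * qᵉ m + qᵒₘ₋₁) * a         ≈⟨ solve 5 (λ a b x y z → z :+ (b :* x :+ y) :* a
                                                             := x :* (b :* a) :+ (a :* y :+ z)) refl a b (qᵉ m) qᵒₘ₋₁ qᵉₘ₋₁ ⟩
      qᵉ m * (b * a) + (a * qᵒₘ₋₁ + qᵉₘ₋₁)   ≈⟨ +-congˡ (Q.evens-step m) ⟨
      qᵉ m * (b * a) + qᵉ m                  ≈⟨ solve 3 (λ a b x → x :* (b :* a) :+ x := x :* (b :* a :+ con 1))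
                                                        refl a b (qᵉ m) ⟩
      qᵉ m * (b * a + 1#)                    ≈⟨ *-congˡ qᵒ-1 ⟨
      qᵉ m * qᵒ (ℤ.+ 1)                      ∎)
    where
      qᵉₘ₋₁ qᵒₘ₋₁ : Carrier
      qᵉₘ₋₁ = qᵉ (m ℤ.- ℤ.+ 1)
      qᵒₘ₋₁ = qᵒ (m ℤ.- ℤ.+ 1)

  lᵒ-subtraction : ∀ m n → lᵒ (m ℤ.- n) + qᵒ m * lᵒ n ≈ qᵉ (m ℤ.+ ℤ.+ 1) * lᵉ n
  lᵒ-subtraction m = recurrent-unique
    (recurrent-+ (recurrent-reflect m lᵒ-recurrent) (recurrent-* (qᵒ m) lᵒ-recurrent))
    (recurrent-* (qᵉ (m ℤ.+ ℤ.+ 1)) lᵉ-recurrent)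
    (begin
      lᵒ (m ℤ.- ℤ.+ 0) + qᵒ m * lᵒ (ℤ.+ 0)      ≈⟨ +-cong (trans (at lᵒ (ℤP.+-identityʳ m)) (lᵒ-as-qᵉ m)) (*-congˡ lᵒ-0) ⟩
      (qᵉ m + qᵉ (m ℤ.+ ℤ.+ 1)) + qᵒ m * a      ≈⟨ solve 4 (λ a x y z → (x :+ z) :+ y :* a := z :+ (a :* y :+ x)) refl
                                                           a (qᵉ m) (qᵒ m) (qᵉ (m ℤ.+ ℤ.+ 1)) ⟩
      qᵉ (m ℤ.+ ℤ.+ 1) + (a * qᵒ m + qᵉ m)      ≈⟨ +-congˡ (Q.evens-suc m) ⟨
      qᵉ (m ℤ.+ ℤ.+ 1) + qᵉ (m ℤ.+ ℤ.+ 1)       ≈⟨ solve 1 (λ z → z :+ z := z :* (con 1 :+ con 1)) refl (qᵉ (m ℤ.+ ℤ.+ 1)) ⟩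
      qᵉ (m ℤ.+ ℤ.+ 1) * two                    ≈⟨ *-congˡ lᵉ-0 ⟨
      qᵉ (m ℤ.+ ℤ.+ 1) * lᵉ (ℤ.+ 0)             ∎)
    (begin
      lᵒ (m ℤ.- ℤ.+ 1) + qᵒ m * lᵒ (ℤ.+ 1)
        ≈⟨ +-cong (trans (lᵒ-as-qᵉ (m ℤ.- ℤ.+ 1)) (+-congˡ (trans (at qᵉ (k-1+1≡k m)) qᵉₘ≈))) (*-cong qᵒₘ≈ lᵒ-1) ⟩
      (e + (a * o + e)) + (b * (a * o + e) + o) * (a * (b * a + two) + a)
        ≈⟨ solve 4 (λ a b e o → (e :+ (a :* o :+ e)) :+ (b :* (a :* o :+ e) :+ o) :* (a :* (b :* a :+ (con 1 :+ con 1)) :+ a)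
                               := (a :* (b :* (a :* o :+ e) :+ o) :+ (a :* o :+ e)) :* (b :* a :+ (con 1 :+ con 1)))
                   refl a b e o ⟩
      (a * (b * (a * o + e) + o) + (a * o + e)) * (b * a + two)
        ≈⟨ *-cong (trans (Q.evens-suc m) (+-cong (*-congˡ qᵒₘ≈) qᵉₘ≈)) lᵉ-1 ⟨
      qᵉ (m ℤ.+ ℤ.+ 1) * lᵉ (ℤ.+ 1) ∎)
    where
      e o : Carrier
      e = qᵉ (m ℤ.- ℤ.+ 1)
      o = qᵒ (m ℤ.- ℤ.+ 1)
      qᵉₘ≈ : qᵉ m ≈ a * o + e
      qᵉₘ≈ = Q.evens-step m
      qᵒₘ≈ : qᵒ m ≈ b * (a * o + e) + o
      qᵒₘ≈ = trans (Q.odds-step m) (+-congʳ (*-congˡ qᵉₘ≈))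

  Δqᵉ-addition : ∀ m n → Δ * qᵉ (m ℤ.+ n ℤ.+ ℤ.+ 1) ≈ lᵒ m * lᵉ (n ℤ.+ ℤ.+ 1) + lᵉ m * lᵒ n
  Δqᵉ-addition m n = begin
    Δ * qᵉ (m ℤ.+ n ℤ.+ ℤ.+ 1)                      ≈⟨ Δqᵉ-suc-as-lᵒ (m ℤ.+ n) ⟩
    lᵒ (m ℤ.+ n) + lᵒ (m ℤ.+ n ℤ.+ ℤ.+ 1)           ≈⟨ +-congˡ (at lᵒ (m+[k+1]≡m+k+1 m n)) ⟨
    lᵒ (m ℤ.+ n) + lᵒ (m ℤ.+ n₁)                    ≈⟨ +-cong (lᵒ-addition m n) (lᵒ-addition m n₁) ⟩
    (lᵒ m * qᵒ n + lᵉ m * qᵉ n) + (lᵒ m * qᵒ n₁ + lᵉ m * qᵉ n₁)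
      ≈⟨ solve 6 (λ x y o e o′ e′ → (x :* o :+ y :* e) :+ (x :* o′ :+ y :* e′) := x :* (o :+ o′) :+ y :* (e :+ e′))
                 refl (lᵒ m) (lᵉ m) (qᵒ n) (qᵉ n) (qᵒ n₁) (qᵉ n₁) ⟩
    lᵒ m * (qᵒ n + qᵒ n₁) + lᵉ m * (qᵉ n + qᵉ n₁)   ≈⟨ +-cong (*-congˡ (lᵉ-suc-as-qᵒ n)) (*-congˡ (lᵒ-as-qᵉ n)) ⟨
    lᵒ m * lᵉ n₁ + lᵉ m * lᵒ n                      ∎
    where
      n₁ : ℤ
      n₁ = n ℤ.+ ℤ.+ 1

  -- The sum of the instances of qᵉ-subtraction at (m, n), (m, n + 1), (m + 1, n) and (m + 1, n + 1);
  -- the recurrence turns the shifted terms q₂₍ₘ₋ₙ₎₊₂ + q₂₍ₘ₋ₙ₎₋₂ into (ab + 2) q₂₍ₘ₋ₙ₎.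
  Δqᵉ-subtraction : ∀ m n → Δ * qᵉ (m ℤ.- n) + lᵉ (m ℤ.+ ℤ.+ 1) * lᵒ n ≈ lᵒ m * lᵉ (n ℤ.+ ℤ.+ 1)
  Δqᵉ-subtraction m n = begin
    Δ * qᵉ d + lᵉ m₁ * lᵒ n
      ≈⟨ +-cong (Δqᵉ-expand d) (*-cong (lᵉ-suc-as-qᵒ m) (lᵒ-as-qᵉ n)) ⟩
    (two * qᵉ d + (qᵉ (d ℤ.+ ℤ.+ 1) + qᵉ (d ℤ.- ℤ.+ 1))) + (qᵒ m + qᵒ m₁) * (qᵉ n + qᵉ n₁)
      ≈⟨ solve 7 (λ z z₊ z₋ o o′ e e′ → ((con 1 :+ con 1) :* z :+ (z₊ :+ z₋)) :+ (o :+ o′) :* (e :+ e′)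
                  := ((z :+ o :* e) :+ (z₋ :+ o :* e′)) :+ ((z₊ :+ o′ :* e) :+ (z :+ o′ :* e′)))
                 refl (qᵉ d) (qᵉ (d ℤ.+ ℤ.+ 1)) (qᵉ (d ℤ.- ℤ.+ 1)) (qᵒ m) (qᵒ m₁) (qᵉ n) (qᵉ n₁) ⟩
    ((qᵉ d + qᵒ m * qᵉ n) + (qᵉ (d ℤ.- ℤ.+ 1) + qᵒ m * qᵉ n₁))
      + ((qᵉ (d ℤ.+ ℤ.+ 1) + qᵒ m₁ * qᵉ n) + (qᵉ d + qᵒ m₁ * qᵉ n₁))
      ≈⟨ +-cong (+-cong (subtraction-at m n ≡.refl) (subtraction-at m n₁ (m-[k+1]≡m-k-1 m n)))
                (+-cong (subtraction-at m₁ n (m+1-k≡m-k+1 m n)) (subtraction-at m₁ n₁ (m+1-[k+1]≡m-k m n))) ⟩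
    (qᵉ m * qᵒ n + qᵉ m * qᵒ n₁) + (qᵉ m₁ * qᵒ n + qᵉ m₁ * qᵒ n₁)
      ≈⟨ solve 4 (λ x x′ y y′ → (x :* y :+ x :* y′) :+ (x′ :* y :+ x′ :* y′) := (x :+ x′) :* (y :+ y′))
                 refl (qᵉ m) (qᵉ m₁) (qᵒ n) (qᵒ n₁) ⟩
    (qᵉ m + qᵉ m₁) * (qᵒ n + qᵒ n₁)
      ≈⟨ *-cong (lᵒ-as-qᵉ m) (lᵉ-suc-as-qᵒ n) ⟨
    lᵒ m * lᵉ n₁ ∎
    where
      d m₁ n₁ : ℤ
      d = m ℤ.- n
      m₁ = m ℤ.+ ℤ.+ 1
      n₁ = n ℤ.+ ℤ.+ 1
      subtraction-at : ∀ {i} m′ n′ → m′ ℤ.- n′ ≡ i → qᵉ i + qᵒ m′ * qᵉ n′ ≈ qᵉ m′ * qᵒ n′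
      subtraction-at m′ n′ eq = trans (+-congʳ (at qᵉ (≡.sym eq))) (qᵉ-subtraction m′ n′)

theorem6 : {c ℓ : Level} (R : CommutativeRing c ℓ) →
    let open CommutativeRing R in
    (a b : Carrier) → ¬ (a ≈ 0#) → ¬ (b ≈ 0#) →
    (q l : ℤ → Carrier) → IsBiFibonacci R a b q → IsBiLucas R a b l →
    (m n : ℤ) →
      ((a * b + four R) * q (ℤ.+ 2 ℤ.* (m ℤ.+ n ℤ.+ ℤ.+ 1))
          ≈ l (ℤ.+ 2 ℤ.* m ℤ.+ ℤ.+ 1) * l (ℤ.+ 2 ℤ.* (n ℤ.+ ℤ.+ 1))
            + l (ℤ.+ 2 ℤ.* m) * l (ℤ.+ 2 ℤ.* n ℤ.+ ℤ.+ 1))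
      × (q (ℤ.+ 2 ℤ.* (m ℤ.+ n))
          ≈ q (ℤ.+ 2 ℤ.* m) * q (ℤ.+ 2 ℤ.* n ℤ.+ ℤ.+ 1)
            + q (ℤ.+ 2 ℤ.* m ℤ.- ℤ.+ 1) * q (ℤ.+ 2 ℤ.* n))
      × (l (ℤ.+ 2 ℤ.* (m ℤ.+ n) ℤ.+ ℤ.+ 1)
          ≈ l (ℤ.+ 2 ℤ.* m ℤ.+ ℤ.+ 1) * q (ℤ.+ 2 ℤ.* n ℤ.+ ℤ.+ 1)
            + l (ℤ.+ 2 ℤ.* m) * q (ℤ.+ 2 ℤ.* n))
      × ((a * b + four R) * q (ℤ.+ 2 ℤ.* (m ℤ.- n))
          ≈ l (ℤ.+ 2 ℤ.* m ℤ.+ ℤ.+ 1) * l (ℤ.+ 2 ℤ.* (n ℤ.+ ℤ.+ 1))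
            - l (ℤ.+ 2 ℤ.* (m ℤ.+ ℤ.+ 1)) * l (ℤ.+ 2 ℤ.* n ℤ.+ ℤ.+ 1))
      × (q (ℤ.+ 2 ℤ.* (m ℤ.- n))
          ≈ q (ℤ.+ 2 ℤ.* m) * q (ℤ.+ 2 ℤ.* n ℤ.+ ℤ.+ 1)
            - q (ℤ.+ 2 ℤ.* m ℤ.+ ℤ.+ 1) * q (ℤ.+ 2 ℤ.* n))
      × (l (ℤ.+ 2 ℤ.* (m ℤ.- n) ℤ.+ ℤ.+ 1)
          ≈ q (ℤ.+ 2 ℤ.* (m ℤ.+ ℤ.+ 1)) * l (ℤ.+ 2 ℤ.* n)
            - q (ℤ.+ 2 ℤ.* m ℤ.+ ℤ.+ 1) * l (ℤ.+ 2 ℤ.* n ℤ.+ ℤ.+ 1))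
theorem6 R a b _ _ q l hq hl m n =
    Δqᵉ-addition m n
  , trans (qᵉ-addition m n) (+-congˡ (*-congʳ (at q (≡.sym (2k-1≡2[k-1]+1 m)))))
  , lᵒ-addition m n
  , move-right (Δqᵉ-subtraction m n)
  , move-right (qᵉ-subtraction m n)
  , move-right (lᵒ-subtraction m n)
  where
    open CommutativeRing R
    open LinearRecurrence R using (at)
    open BiPeriodicIdentities R a b q l hq hl
    open Index
    open import Algebra.Properties.Group +-group using (x≈z//y)
    move-right : ∀ {x y z} → x + y ≈ z → x ≈ z - y
    move-right = x≈z//y _ _ _
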